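{- For any \textbf{wA2}-space $(\mathcal{R},\leq,r)$, the collection of Kastanas Ramsey subsets of $\mathcal{R}$ is closed under countable unions.
   Context: $\mathcal{R}$ nonempty, $\le$ quasi-order on $\mathcal{R}$, $r:\mathcal{R}\times\omega\to\mathcal{AR}$, $r_n(A):=r(A,n)$, $\mathcal{AR}_n$ the image of $r_n$. A1: (1) $r_0(A)=\emptyset$; (2) $A\ne B\Rightarrow r_n(A)\ne r_n(B)$ for some $n$; (3) $r_n(A)=r_m(B)\Rightarrow n=m$ and $r_k(A)=r_k(B)$ for $k<n$. $\mathrm{lh}(a)$: the $n$ with $a\in\mathcal{AR}_n$; $a\sqsubseteq b$ iff $a=r_m(A)$, $b=r_n(A)$ for some $A$, $m\le n$. wA2: a quasi-order $\leq_{\mathrm{fin}}$ on $\mathcal{AR}$ with (w1) $\{a:a\leq_{\mathrm{fin}}b\}$ countable; (2) $A\le B$ iff $\forall n\exists m\ r_n(A)\leq_{\mathrm{fin}}r_m(B)$; (3) $a\sqsubseteq b\leq_{\mathrm{fin}}c\Rightarrow\exists d\sqsubseteq c\ a\leq_{\mathrm{fin}}d$. $[a,A]=\{B\le A:\exists n\ r_n(B)=a\}$; $[n,A]=[r_n(A),A]$; $\mathrm{depth}_B(a)=\min\{n:a\leq_{\mathrm{fin}}r_n(B)\}$ or $\infty$; $\mathcal{AR}{\upharpoonright}A=\{a:\exists n\ a\leq_{\mathrm{fin}}r_n(A)\}$; $r_n[a,A]=\{b\in\mathcal{AR}{\upharpoonright}A:a\sqsubseteq b,\mathrm{lh}(b)=n\}$.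 A3: (1) $\mathrm{depth}_B(a)<\infty\Rightarrow[a,A]\ne\emptyset$ for all $A\in[\mathrm{depth}_B(a),B]$; (2) $A\le B$, $[a,A]\ne\emptyset\Rightarrow\exists A'\in[\mathrm{depth}_B(a),B]$ with $\emptyset\ne[a,A']\subseteq[a,A]$. A \textbf{wA2}-space: A1, wA2, A3 hold and $\mathcal{R}$ (identified with $\{(r_n(A))_n\}$) is closed in $\mathcal{AR}^{\mathbb N}$. Kastanas game $K[a,A]$: with $a_0=a$, $B_{ -1}=A$, in round $n\ge0$ I plays $A_n\in[a_n,B_{n-1}]$, then II plays $a_{n+1}\in r_{\mathrm{lh}(a_n)+1}[a_n,A_n]$ and $B_n\in[a_{n+1},A_n]$; outcome: the $B$ with $r_{\mathrm{lh}(a)+n}(B)=a_n$ for all $n$. $\mathcal{X}\subseteq\mathcal{R}$ is Kastanas Ramsey if for all $A$ and $a\in\mathcal{AR}{\upharpoonright}A$ there is $B\in[a,A]$ such that I has a strategy in $K[a,B]$ ensuring the outcome lies in $\mathcal{X}^c$, or II has a strategy in $K[a,B]$ ensuring the outcome lies in $\mathcal{X}$. -}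

module Defs where

open import Data.Nat using (ℕ; zero; suc; _+_; _≤_; _<_)
open import Data.Maybe using (Maybe; just)
open import Data.Product using (Σ; ∃; ∃-syntax; _×_; _,_; proj₁; proj₂)
open import Data.Sum using (_⊎_)
open import Data.List using (List; map; upTo)
open import Relation.Nullary using (¬_)
open import Relation.Binary.PropositionalEquality using (_≡_; _≢_)

record Structure : Set₁ where
  field
    R     : Set
    AR    : Set
    _≤R_  : R → R → Set
    r     : R → ℕ → AR           -- r n A = r(A , n) is written  r A n
    _≤fin_ : AR → AR → Set
    ∅     : AR

module Notions (S : Structure) where
  open Structure S

  Lh : AR → ℕ → Set
  Lh a n = ∃[ A ] (r A n ≡ a)

  _⊑_ : AR → AR → Set
  a ⊑ b = ∃[ A ] ∃[ m ] ∃[ n ] (m ≤ n × r A m ≡ a × r A n ≡ b)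

  In[_,_] : AR → R → R → Set
  In[ a , A ] B = B ≤R A × ∃[ n ] (r B n ≡ a)

  IsDepth : R → AR → ℕ → Set
  IsDepth B a n = a ≤fin r B n × (∀ m → a ≤fin r B m → n ≤ m)

  AR↾ : R → AR → Set
  AR↾ A a = ∃[ n ] (a ≤fin r A n)

  rSet : ℕ → AR → R → AR → Set
  rSet n a A b = AR↾ A b × a ⊑ b × Lh b n

  -- Kastanas game K[a , A].
  -- A play is described by I's moves  Is : ℕ → R  (I plays A_n = Is n)
  -- and II's moves  IIs : ℕ → AR × R  (II plays (a_{n+1} , B_n) = IIs n).

  module Play (a : AR) (A : R) (Is : ℕ → R) (IIs : ℕ → AR × R) where
    pos : ℕ → AR
    pos zero    = a
    pos (suc n) = proj₁ (IIs n)

    -- B_{n-1}  (with B_{-1} = A)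
    prev : ℕ → R
    prev zero    = A
    prev (suc n) = proj₂ (IIs n)

    LegalI : ℕ → Set
    LegalI n = In[ pos n , prev n ] (Is n)

    LegalII : ℕ → Set
    LegalII n =
      (∃[ m ] (Lh (pos n) m × rSet (suc m) (pos n) (Is n) (pos (suc n))))
      × In[ pos (suc n) , Is n ] (prev (suc n))

    IsOutcome : R → Set
    IsOutcome C = ∀ m → Lh a m → ∀ n → r C (m + n) ≡ pos n

    OutcomeIn : (R → Set) → Set
    OutcomeIn 𝒮 = ∀ C → IsOutcome C → 𝒮 C

  take : {X : Set} → ℕ → (ℕ → X) → List X
  take n s = map s (upTo n)

  StrategyI : Set
  StrategyI = List (AR × R) → R

  -- A strategy for II: given I's moves so far (including the current
  -- one), choose II's next move.
  StrategyII : Set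
  StrategyII = List R → AR × R

  IWinsWith : AR → R → (R → Set) → StrategyI → Set
  IWinsWith a A 𝒮 σ =
    ∀ (IIs : ℕ → AR × R) →
      let Is : ℕ → R
          Is n = σ (take n IIs)
          open Play a A Is IIs
      in (∀ n → (∀ k → k < n → LegalII k) → LegalI n)
         × ((∀ n → LegalII n) → OutcomeIn 𝒮)

  IIWinsWith : AR → R → (R → Set) → StrategyII → Set
  IIWinsWith a A 𝒮 τ =
    ∀ (Is : ℕ → R) →
      let IIs : ℕ → AR × R
          IIs n = τ (take (suc n) Is)
          open Play a A Is IIs
      in (∀ n → (∀ k → k ≤ n → LegalI k) → LegalII n)
         × ((∀ n → LegalI n) → OutcomeIn 𝒮)

  IHasStrategy : AR → R → (R → Set) → Set
  IHasStrategy a A 𝒮 = ∃[ σ ] IWinsWith a A 𝒮 σ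

  IIHasStrategy : AR → R → (R → Set) → Set
  IIHasStrategy a A 𝒮 = ∃[ τ ] IIWinsWith a A 𝒮 τ

  KastanasRamsey : (R → Set) → Set
  KastanasRamsey 𝒳 =
    ∀ (A : R) (a : AR) → AR↾ A a →
      ∃[ B ] (In[ a , A ] B
              × (IHasStrategy a B (λ C → ¬ 𝒳 C) ⊎ IIHasStrategy a B 𝒳))

record IsWA2Space (S : Structure) : Set₁ where
  open Structure S
  open Notions S
  field
    ≤-refl  : ∀ A → A ≤R A
    ≤-trans : ∀ {A B C} → A ≤R B → B ≤R C → A ≤R C
    nonempty : R
    A1-1 : ∀ A → r A 0 ≡ ∅
    A1-2 : ∀ A B → A ≢ B → ∃[ n ] (r A n ≢ r B n)
    A1-3 : ∀ A B n m → r A n ≡ r B m → n ≡ m × (∀ k → k < n → r A k ≡ r B k)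
    ≤fin-refl  : ∀ a → a ≤fin a
    ≤fin-trans : ∀ {a b c} → a ≤fin b → b ≤fin c → a ≤fin c
    -- (w1) { a : a ≤fin b } is countable (possibly finite)
    w1 : ∀ b → Σ (ℕ → Maybe AR) λ f → ((∀ a → a ≤fin b → ∃[ n ] (f n ≡ just a))
                        × (∀ n a → f n ≡ just a → a ≤fin b))
    w2⇒ : ∀ A B → A ≤R B → ∀ n → ∃[ m ] (r A n ≤fin r B m)
    w2⇐ : ∀ A B → (∀ n → ∃[ m ] (r A n ≤fin r B m)) → A ≤R B
    w3 : ∀ a b c → a ⊑ b → b ≤fin c → ∃[ d ] (d ⊑ c × a ≤fin d)
    A3-1 : ∀ B a n → IsDepth B a n →
             ∀ A → In[ r B n , B ] A → ∃[ C ] In[ a , A ] C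
    A3-2 : ∀ A B a → A ≤R B → ∃[ C ] In[ a , A ] C →
             ∃[ n ] (IsDepth B a n
               × ∃[ A' ] (In[ r B n , B ] A'
                 × ∃[ C ] In[ a , A' ] C
                 × (∀ C → In[ a , A' ] C → In[ a , A ] C)))
    -- R, identified with {(r_n(A))_n}, is closed in AR^ℕ
    -- (product of discrete topologies)
    closed : ∀ (s : ℕ → AR) →
               (∀ n → ∃[ A ] (∀ k → k < n → r A k ≡ s k)) →
               ∃[ A ] (∀ k → r A k ≡ s k)

{-# OPTIONS --safe #-}
-- Call C good for b if II has a strategy for ⋃ₙ 𝒳ₙ in K[b , D] for some D ∈ [b , C], and bad
-- otherwise.  If some B₀ ∈ [a , A] is good for a we are done; if not, I wins for the complement by
-- diagonalising.  At each new position b = a_j, I first passes to some E below which every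
-- one-step extension of b is bad (were there none, II could win from b by moving to a good
-- extension), then uses that 𝒳_j is Kastanas Ramsey to find D ∈ [b , E] and a strategy σ_j for I
-- avoiding 𝒳_j (a strategy of II for 𝒳_j would make b good).  From then on every move of I is
-- threaded through the answers of all the games σ_0, σ_1, … started so far.  Badness passes to
-- each new position, so game j can always be started, and the outcome of the whole play is an
-- outcome of every game j, hence avoids every 𝒳_j.
module Submission where

open import Defs
open import Level using (0ℓ)
open import Data.Nat using (ℕ)
open import Data.Product using (∃-syntax)
open import Axiom.ExcludedMiddle using (ExcludedMiddle)

open import Data.Nat using (zero; suc; _+_; _∸_; _≤_; _<_; z≤n; s≤s)
import Data.Nat.Properties as ℕ
open import Data.Nat.Induction using (<-rec)
open import Data.Product using (_×_; _,_; proj₁; proj₂)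
open import Data.Sum using (_⊎_; inj₁; inj₂)
open import Data.List using (List; []; _∷_; [_]; _∷ʳ_; map; foldl; length; applyUpTo; upTo)
open import Data.List.Properties
  using (map-upTo; map-applyUpTo; map-++; length-applyUpTo; foldl-∷ʳ; upTo-∷ʳ)
open import Data.Empty using (⊥-elim)
open import Function using (_∘_)
open import Relation.Nullary using (¬_; Dec; yes; no)
open import Relation.Nullary.Decidable using (decidable-stable)
open import Relation.Binary.PropositionalEquality
  using (_≡_; refl; sym; trans; cong; cong₂; subst; subst₂; module ≡-Reasoning)

<-suc-extend : ∀ {P : ℕ → Set} {j} → (∀ k → k < j → P k) → P j → ∀ k → k < suc j → P k
<-suc-extend below here k k<1+j with ℕ.m<1+n⇒m<n∨m≡n k<1+j
... | inj₁ k<j  = below k k<j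
... | inj₂ refl = here

module _ {X : Set} where

  lookupOr : X → List X → ℕ → X
  lookupOr d []      _       = d
  lookupOr d (x ∷ _) zero    = x
  lookupOr d (_ ∷ L) (suc k) = lookupOr d L k

  lookupOr-applyUpTo : ∀ d (f : ℕ → X) {n k} → k < n → lookupOr d (applyUpTo f n) k ≡ f k
  lookupOr-applyUpTo d f {suc n} {zero}  _         = refl
  lookupOr-applyUpTo d f {suc n} {suc k} (s≤s k<n) = lookupOr-applyUpTo d (f ∘ suc) k<n

  applyUpTo-cong : ∀ {f g : ℕ → X} n → (∀ k → k < n → f k ≡ g k) → applyUpTo f n ≡ applyUpTo g n
  applyUpTo-cong         zero    _   = refl
  applyUpTo-cong {f} {g} (suc n) f≗g =
    cong₂ _∷_ (f≗g 0 (s≤s z≤n))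
              (applyUpTo-cong {f ∘ suc} {g ∘ suc} n (λ k k<n → f≗g (suc k) (s≤s k<n)))

  lookupOr-map-upTo : ∀ d (s : ℕ → X) {n k} → k < n → lookupOr d (map s (upTo n)) k ≡ s k
  lookupOr-map-upTo d s {n} {k} k<n =
    trans (cong (λ L → lookupOr d L k) (map-upTo s n)) (lookupOr-applyUpTo d s k<n)

  length-map-upTo : ∀ (s : ℕ → X) n → length (map s (upTo n)) ≡ n
  length-map-upTo s n = trans (cong length (map-upTo s n)) (length-applyUpTo s n)

  map-upTo-cong : ∀ {f g : ℕ → X} n → (∀ k → k < n → f k ≡ g k) → map f (upTo n) ≡ map g (upTo n)
  map-upTo-cong {f} {g} n f≗g =
    trans (map-upTo f n) (trans (applyUpTo-cong n f≗g) (sym (map-upTo g n)))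

  map-applyUpTo-suc : ∀ (s : ℕ → X) n → map s (applyUpTo suc n) ≡ map (s ∘ suc) (upTo n)
  map-applyUpTo-suc s n = trans (map-applyUpTo suc s n) (sym (map-upTo (s ∘ suc) n))

  foldl-map-upTo-suc : ∀ {Y : Set} (f : Y → X → Y) y (s : ℕ → X) n →
                       foldl f y (map s (upTo (suc n))) ≡ f (foldl f y (map s (upTo n))) (s n)
  foldl-map-upTo-suc f y s n = begin
    foldl f y (map s (upTo (suc n)))    ≡⟨ cong (foldl f y ∘ map s) (sym (upTo-∷ʳ n)) ⟩
    foldl f y (map s (upTo n ∷ʳ n))     ≡⟨ cong (foldl f y) (map-++ s (upTo n) [ n ]) ⟩
    foldl f y (map s (upTo n) ∷ʳ s n)   ≡⟨ foldl-∷ʳ f y (s n) (map s (upTo n)) ⟩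
    f (foldl f y (map s (upTo n))) (s n) ∎
    where open ≡-Reasoning

module _ (S : Structure) (W : IsWA2Space S) where
  open Structure S
  open Notions S
  open IsWA2Space W

  infix 4 _◁_
  _◁_ : AR → R → Set
  b ◁ C = ∃[ n ] (r C n ≡ b)

  ◁⇒AR↾ : ∀ {b C} → b ◁ C → AR↾ C b
  ◁⇒AR↾ (n , refl) = n , ≤fin-refl _

  ◁⇒Lh : ∀ {b C} (b◁C : b ◁ C) → Lh b (proj₁ b◁C)
  ◁⇒Lh {C = C} (_ , e) = C , e

  Lh-unique : ∀ {b m n} → Lh b m → Lh b n → m ≡ n
  Lh-unique {m = m} {n} (A , eA) (B , eB) = proj₁ (A1-3 A B m n (trans eA (sym eB)))

  In-mono : ∀ {b X Y Z} → In[ b , X ] Y → X ≤R Z → In[ b , Z ] Y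
  In-mono (Y≤X , b◁Y) X≤Z = ≤-trans Y≤X X≤Z , b◁Y

  AR↾-mono : ∀ {X Y c} → X ≤R Y → AR↾ X c → AR↾ Y c
  AR↾-mono {X} {Y} X≤Y (n , c≤rXn) =
    let m , rXn≤rYm = w2⇒ X Y X≤Y n in m , ≤fin-trans c≤rXn rXn≤rYm

  OneStep : AR → R → AR → Set
  OneStep b A b′ = ∃[ m ] (Lh b m × rSet (suc m) b A b′)

  OneStep-mono : ∀ {b A A′ b′} → A ≤R A′ → OneStep b A b′ → OneStep b A′ b′
  OneStep-mono A≤A′ (m , lb , b′∈ , b⊑b′ , lb′) = m , lb , AR↾-mono A≤A′ b′∈ , b⊑b′ , lb′

  OneStep-Lh : ∀ {b A b′ m} → OneStep b A b′ → Lh b m → Lh b′ (suc m)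
  OneStep-Lh {b′ = b′} (k , lk , _ , _ , lb′) lm = subst (λ n → Lh b′ (suc n)) (Lh-unique lk lm) lb′

  MoveII : AR → R → AR × R → Set
  MoveII b A (b′ , B) = OneStep b A b′ × In[ b′ , A ] B

  MoveII-weaken : ∀ {b A A′ b′ B B′} → MoveII b A (b′ , B) → A ≤R A′ → In[ b′ , B ] B′ →
                  MoveII b A′ (b′ , B′)
  MoveII-weaken (step , B≤A , _) A≤A′ (B′≤B , b′◁B′) =
    OneStep-mono A≤A′ step , ≤-trans B′≤B (≤-trans B≤A A≤A′) , b′◁B′

  descending-≤ : ∀ (c : ℕ → R) {j} → (∀ k → k < j → c (suc k) ≤R c k) →
                 ∀ {j′} → j′ ≤ j → c j ≤R c j′
  descending-≤ c {zero}  _   z≤n = ≤-refl (c 0)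
  descending-≤ c {suc j} dec j′≤1+j with ℕ.m≤n⇒m<n∨m≡n j′≤1+j
  ... | inj₁ j′<1+j = ≤-trans (dec j (ℕ.n<1+n j))
                              (descending-≤ c (λ k k<j → dec k (ℕ.m<n⇒m<1+n k<j)) (ℕ.≤-pred j′<1+j))
  ... | inj₂ refl   = ≤-refl (c (suc j))

  descending-In : ∀ (c : ℕ → R) {b j} → b ◁ c 0 → (∀ k → k < j → In[ b , c k ] (c (suc k))) →
                  In[ b , c 0 ] (c j)
  descending-In c {j = zero}  b◁c₀ _     = ≤-refl (c 0) , b◁c₀
  descending-In c {j = suc j} _    steps =
    descending-≤ c (λ k k<1+j → proj₁ (steps k k<1+j)) z≤n , proj₂ (steps j (ℕ.n<1+n j))

  Follows : R → (ℕ → AR) → Set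
  Follows C p = ∀ m → Lh (p 0) m → ∀ n → r C (m + n) ≡ p n

  Follows-drop : ∀ {C p q} j {m} → Lh (p 0) m → Lh (q 0) (j + m) → (∀ t → q t ≡ p (j + t)) →
                 Follows C p → Follows C q
  Follows-drop {C} {p} {q} j {m} lp lq q≡p C-follows m′ lq′ t = begin
    r C (m′ + t)       ≡⟨ cong (λ k → r C (k + t)) (Lh-unique lq′ lq) ⟩
    r C (j + m + t)    ≡⟨ cong (λ k → r C (k + t)) (ℕ.+-comm j m) ⟩
    r C (m + j + t)    ≡⟨ cong (r C) (ℕ.+-assoc m j t) ⟩
    r C (m + (j + t))  ≡⟨ C-follows m lp (j + t) ⟩
    p (j + t)          ≡⟨ sym (q≡p t) ⟩
    q t                ∎
    where open ≡-Reasoning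

  ILegal : AR → R → StrategyI → Set
  ILegal b A σ = ∀ (IIs : ℕ → AR × R) →
    let open Play b A (λ n → σ (take n IIs)) IIs
    in ∀ n → (∀ k → k < n → LegalII k) → LegalI n

  IIWinsPlay : AR → R → (R → Set) → (ℕ → R) → (ℕ → AR × R) → Set
  IIWinsPlay b A 𝒮 Is IIs = let open Play b A Is IIs in
    (∀ n → (∀ k → k ≤ n → LegalI k) → LegalII n) × ((∀ n → LegalI n) → OutcomeIn 𝒮)

  -- I replays the set II has just played (D in round 0): legal, but otherwise arbitrary
  copycat : R → StrategyI
  copycat = foldl (λ _ move → proj₂ move)

  copycat-legal : ∀ {b D} → b ◁ D → ILegal b D (copycat D)
  copycat-legal {D = D} b◁D IIs zero    _            = ≤-refl D , b◁D
  copycat-legal {D = D} b◁D IIs (suc n) II-legal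
    rewrite foldl-map-upTo-suc (λ _ move → proj₂ move) D IIs n =
    ≤-refl (proj₂ (IIs n)) , proj₂ (proj₂ (II-legal n (ℕ.n<1+n n)))

  LegalReduction : AR → R → R × StrategyI → Set
  LegalReduction b C (D , σ) = In[ b , C ] D × ILegal b D σ

  module _ (𝒮 : R → Set) where

    Good : AR → R → Set
    Good b C = ∃[ D ] (In[ b , C ] D × IIHasStrategy b D 𝒮)

    Bad : AR → R → Set
    Bad b C = ¬ Good b C

    Bad-antitone : ∀ {b X C} → X ≤R C → Bad b C → Bad b X
    Bad-antitone X≤C bad (D , D∈ , τ) = bad (D , In-mono D∈ X≤C , τ)

    SuccessorsBad : AR → R → Set
    SuccessorsBad b E = ∀ {b′} → OneStep b E b′ → Bad b′ E

    SuccessorsBad-antitone : ∀ {b X E} → X ≤R E → SuccessorsBad b E → SuccessorsBad b X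
    SuccessorsBad-antitone X≤E bad step = Bad-antitone X≤E (bad (OneStep-mono X≤E step))

    SuccessorsBadBelow : AR → R → Set
    SuccessorsBadBelow b C = ∃[ E ] (In[ b , C ] E × SuccessorsBad b E)

    HasGoodSuccessor : AR → R → Set
    HasGoodSuccessor b X = ∃[ b′ ] (OneStep b X b′ × Good b′ X)

  module _ (em : ExcludedMiddle 0ℓ) (𝒮 : R → Set) where

    continueFrom : (b : AR) (X : R) → Dec (HasGoodSuccessor 𝒮 b X) → List R → AR × R
    continueFrom b X (yes (b′ , _ , D , _ , τ , _)) []      = b′ , D
    continueFrom b X (yes (b′ , _ , D , _ , τ , _)) (Y ∷ L) = τ (Y ∷ L)
    continueFrom b X (no _)                         _       = b , X

    -- II answers I's first move X by a good successor b′ of b in X (if there is one), and then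
    -- follows a winning strategy in K[b′ , D]; the clause for the empty history is never consulted
    glued : AR → R → StrategyII
    glued b C []      = b , C
    glued b C (X ∷ L) = continueFrom b X em L

    module _ {b C} (b◁C : b ◁ C) (noE : ¬ SuccessorsBadBelow 𝒮 b C)
             (Is : ℕ → R) where

      continueFrom-wins : (d : Dec (HasGoodSuccessor 𝒮 b (Is 0))) →
        IIWinsPlay b C 𝒮 Is (λ n → continueFrom b (Is 0) d (map Is (applyUpTo suc n)))
      continueFrom-wins (no noGood) = (λ _ legal → ⊥-elim (I₀-illegal (legal 0 z≤n)))
                                    , (λ legal → ⊥-elim (I₀-illegal (legal 0)))
        where
        I₀-illegal : ¬ In[ b , C ] (Is 0)
        I₀-illegal I₀∈ = noE (Is 0 , I₀∈ , λ step good → noGood (_ , step , good))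
      continueFrom-wins good@(yes (b′ , step , D , D∈ , τ , τ-wins)) = II-legal , II-wins
        where
        IIs : ℕ → AR × R
        IIs n = continueFrom b (Is 0) good (map Is (applyUpTo suc n))
        module Main = Play b C Is IIs
        module Tail = Play b′ D (Is ∘ suc) (λ k → τ (take (suc k) (Is ∘ suc)))
        tail = τ-wins (Is ∘ suc)

        state : ∀ k → IIs k ≡ (Tail.pos k , Tail.prev k)
        state zero    = refl
        state (suc k) = cong τ (map-applyUpTo-suc Is (suc k))

        LegalI-tail : ∀ k → Main.LegalI (suc k) → Tail.LegalI k
        LegalI-tail k = subst (λ m → In[ proj₁ m , proj₂ m ] (Is (suc k))) (state k)

        LegalII-untail : ∀ k → Tail.LegalII k → Main.LegalII (suc k)
        LegalII-untail k =
          subst₂ (λ m m′ → MoveII (proj₁ m) (Is (suc k)) m′) (sym (state k)) (sym (state (suc k)))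

        II-legal : ∀ n → (∀ k → k ≤ n → Main.LegalI k) → Main.LegalII n
        II-legal zero    _     = step , D∈
        II-legal (suc n) legal =
          LegalII-untail n (proj₁ tail n (λ k k≤n → LegalI-tail k (legal (suc k) (s≤s k≤n))))

        II-wins : (∀ n → Main.LegalI n) → Main.OutcomeIn 𝒮
        II-wins legal C′ follows =
          proj₂ tail (λ k → LegalI-tail k (legal (suc k)))
            C′ (Follows-drop 1 (◁⇒Lh b◁C) (OneStep-Lh step (◁⇒Lh b◁C))
                 (λ t → cong proj₁ (sym (state t))) follows)

    bad⇒successorsBadBelow : ∀ {b C} → b ◁ C → Bad 𝒮 b C → SuccessorsBadBelow 𝒮 b C
    bad⇒successorsBadBelow {b} {C} b◁C bad = decidable-stable em λ noE →
      bad (C , (≤-refl C , b◁C) , glued b C , λ Is → continueFrom-wins b◁C noE Is em)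

  module Diagonal (reduce : ℕ → AR → R → R × StrategyI)
                  (reduce-legal : ∀ j {b C} → b ◁ C → LegalReduction b C (reduce j b C))
                  (a : AR) (B₀ : R) where

    pos : (ℕ → AR × R) → ℕ → AR
    pos s zero    = a
    pos s (suc n) = proj₁ (s n)

    prev : (ℕ → AR × R) → ℕ → R
    prev s zero    = B₀
    prev s (suc n) = proj₂ (s n)

    gameSet : ℕ → AR → R → R
    gameSet j b C = proj₁ (reduce j b C)

    gameStrategy : ℕ → AR → R → StrategyI
    gameStrategy j b C = proj₂ (reduce j b C)

    -- s lists II's moves (a_{i+1} , B_i), so pos s i = a_i and prev s i = B_{i-1}.  Game j is a
    -- play of K[a_j , gameSet j a_j (stage s j j)] by I's strategy gameStrategy j a_j (stage s j j),
    -- started in round j.  stage s j i is the set reached in round i once games 0, …, j-1 have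
    -- answered, starting from stage s 0 i = B_{i-1}; I plays stage s (suc i) i.  In game j, II's
    -- answer to I's t-th move is (a_{j+t+1} , stage s j (j+t+1)).
    mutual
      stage : (ℕ → AR × R) → ℕ → ℕ → R
      stage s zero    i = prev s i
      stage s (suc j) i = auxI s j (i ∸ j)

      auxI : (ℕ → AR × R) → ℕ → ℕ → R
      auxI s j t = gameStrategy j (pos s j) (stage s j j) (take t (auxII s j))

      auxII : (ℕ → AR × R) → ℕ → ℕ → AR × R
      auxII s j t = pos s (suc (j + t)) , stage s j (suc (j + t))

    δ : StrategyI
    δ L = stage (lookupOr (a , B₀) L) (suc (length L)) (length L)

    Agree : (ℕ → AR × R) → (ℕ → AR × R) → ℕ → Set
    Agree s s′ n = ∀ k → k < n → s k ≡ s′ k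

    Agree-weaken : ∀ {s s′ m n} → m ≤ n → Agree s s′ n → Agree s s′ m
    Agree-weaken m≤n agree k k<m = agree k (ℕ.<-≤-trans k<m m≤n)

    pos-cong : ∀ {s s′} i → Agree s s′ i → pos s i ≡ pos s′ i
    pos-cong zero    _     = refl
    pos-cong (suc i) agree = cong proj₁ (agree i (ℕ.n<1+n i))

    prev-cong : ∀ {s s′} i → Agree s s′ i → prev s i ≡ prev s′ i
    prev-cong zero    _     = refl
    prev-cong (suc i) agree = cong proj₂ (agree i (ℕ.n<1+n i))

    stage-cong : ∀ {s s′} j {i} → j ≤ suc i → Agree s s′ i → stage s j i ≡ stage s′ j i
    stage-cong zero    {i} _         agree = prev-cong i agree
    stage-cong {s} {s′} (suc j) {i} (s≤s j≤i) agree =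
      cong₂ (λ bC L → gameStrategy j (proj₁ bC) (proj₂ bC) L)
            (cong₂ _,_ (pos-cong j agree-j) (stage-cong j (ℕ.n≤1+n j) agree-j))
            (map-upTo-cong (i ∸ j) auxII-agree)
      where
      agree-j : Agree s s′ j
      agree-j = Agree-weaken j≤i agree
      auxII-agree : ∀ t → t < i ∸ j → auxII s j t ≡ auxII s′ j t
      auxII-agree t t<i∸j = cong₂ _,_ (pos-cong (suc (j + t)) agree-t)
                                      (stage-cong j j≤2+j+t agree-t)
        where
        1+j+t≤i : suc (j + t) ≤ i
        1+j+t≤i = subst (suc (j + t) ≤_) (ℕ.m+[n∸m]≡n j≤i) (ℕ.+-monoʳ-< j t<i∸j)
        agree-t : Agree s s′ (suc (j + t))
        agree-t = Agree-weaken 1+j+t≤i agree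
        j≤2+j+t : j ≤ suc (suc (j + t))
        j≤2+j+t = ℕ.m≤n⇒m≤1+n (ℕ.m≤n⇒m≤1+n (ℕ.m≤m+n j t))

    δ-take : ∀ s n → δ (take n s) ≡ stage s (suc n) n
    δ-take s n = begin
      stage s′ (suc (length (take n s))) (length (take n s))
        ≡⟨ cong (λ ℓ → stage s′ (suc ℓ) ℓ) (length-map-upTo s n) ⟩
      stage s′ (suc n) n
        ≡⟨ stage-cong (suc n) ℕ.≤-refl (λ k k<n → lookupOr-map-upTo (a , B₀) s k<n) ⟩
      stage s (suc n) n ∎
      where
      open ≡-Reasoning
      s′ = lookupOr (a , B₀) (take n s)

    module _ (a◁B₀ : a ◁ B₀) (s : ℕ → AR × R) where

      module Aux (j : ℕ) = Play (pos s j) (gameSet j (pos s j) (stage s j j)) (auxI s j) (auxII s j)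

      MovesValidBefore : ℕ → Set
      MovesValidBefore n = ∀ k → k < n → MoveII (pos s k) (stage s (suc k) k) (s k)

      Step : ℕ → ℕ → Set
      Step i j = In[ pos s i , stage s j i ] (stage s (suc j) i)

      RoundValid : ℕ → Set
      RoundValid i = ∀ j → j < suc i → Step i j

      valid-weaken : ∀ {m n} → m ≤ n → MovesValidBefore n → MovesValidBefore m
      valid-weaken m≤n valid k k<m = valid k (ℕ.<-≤-trans k<m m≤n)

      pos◁prev : ∀ {i} → MovesValidBefore i → pos s i ◁ prev s i
      pos◁prev {zero}  _     = a◁B₀
      pos◁prev {suc i} valid = proj₂ (proj₂ (valid i (ℕ.n<1+n i)))

      stage∈prev : ∀ {i j} → MovesValidBefore i → (∀ k → k < j → Step i k) →
                   In[ pos s i , prev s i ] (stage s j i)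
      stage∈prev {i} valid steps = descending-In (λ k → stage s k i) (pos◁prev valid) steps

      aux-pos : ∀ j t → Aux.pos j t ≡ pos s (j + t)
      aux-pos j zero    = cong (pos s) (sym (ℕ.+-identityʳ j))
      aux-pos j (suc t) = cong (pos s) (sym (ℕ.+-suc j t))

      stage≡auxI : ∀ j t → stage s (suc j) (j + t) ≡ auxI s j t
      stage≡auxI j t = cong (auxI s j) (ℕ.m+n∸m≡n j t)

      aux-LegalII : ∀ {j k} → MovesValidBefore (suc (j + k)) → RoundValid (j + k) →
                    (∀ j′ → j′ < j → Step (suc (j + k)) j′) → Aux.LegalII j k
      aux-LegalII {j} {k} valid round steps =
        subst (λ b → MoveII b (auxI s j k) (auxII s j k)) (sym (aux-pos j k))
              (MoveII-weaken (valid (j + k) (ℕ.n<1+n _)) move≤auxI (stage∈prev valid steps))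
        where
        move≤auxI : stage s (suc (j + k)) (j + k) ≤R auxI s j k
        move≤auxI = subst (stage s (suc (j + k)) (j + k) ≤R_) (stage≡auxI j k)
                      (descending-≤ (λ j′ → stage s j′ (j + k)) (λ j′ j′<1+i → proj₁ (round j′ j′<1+i))
                                    (s≤s (ℕ.m≤m+n j k)))

      aux-LegalI : ∀ {j t} → pos s j ◁ stage s j j → (∀ k → k < t → Aux.LegalII j k) →
                   Aux.LegalI j t
      aux-LegalI {j} {t} pos◁stage = proj₂ (reduce-legal j pos◁stage) (auxII s j) t

      auxI∈stage : ∀ {j} t → pos s j ◁ stage s j j → Aux.LegalI j t →
                   In[ pos s (j + t) , stage s j (j + t) ] (auxI s j t)
      auxI∈stage {j} zero pos◁stage legal rewrite ℕ.+-identityʳ j =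
        In-mono legal (proj₁ (proj₁ (reduce-legal j pos◁stage)))
      auxI∈stage {j} (suc t) _ legal rewrite ℕ.+-suc j t = legal

      step : ∀ {i j} → MovesValidBefore i → (∀ {i′} → i′ < i → RoundValid i′) →
             (∀ k → k < j → Step i k) → j ≤ i → Step i j
      step {j = j} valid rounds steps j≤i with ℕ.m≤n⇒∃[o]m+o≡n j≤i
      ... | t , refl = subst (In[ pos s (j + t) , stage s j (j + t) ]) (sym (stage≡auxI j t))
                             (auxI∈stage t pos◁stage (aux-LegalI pos◁stage aux-valid))
        where
        steps-left : ∀ {i′} → i′ ≤ j + t → j ≤ i′ → ∀ k → k < j → Step i′ k
        steps-left i′≤i j≤i′ k k<j with ℕ.m≤n⇒m<n∨m≡n i′≤i
        ... | inj₁ i′<i = rounds i′<i k (ℕ.m<n⇒m<1+n (ℕ.<-≤-trans k<j j≤i′))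
        ... | inj₂ refl = steps k k<j
        pos◁stage : pos s j ◁ stage s j j
        pos◁stage = proj₂ (stage∈prev (valid-weaken (ℕ.m≤m+n j t) valid)
                                      (steps-left (ℕ.m≤m+n j t) ℕ.≤-refl))
        aux-valid : ∀ k → k < t → Aux.LegalII j k
        aux-valid k k<t = aux-LegalII (valid-weaken 1+j+k≤i valid) (rounds 1+j+k≤i)
                                      (steps-left 1+j+k≤i (ℕ.m≤n⇒m≤1+n (ℕ.m≤m+n j k)))
          where
          1+j+k≤i : suc (j + k) ≤ j + t
          1+j+k≤i = subst (_≤ j + t) (ℕ.+-suc j k) (ℕ.+-monoʳ-≤ j k<t)

      steps-below : ∀ {i} → MovesValidBefore i → (∀ {i′} → i′ < i → RoundValid i′) →
                    ∀ j → j ≤ suc i → ∀ k → k < j → Step i k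
      steps-below valid rounds zero    _       = λ _ ()
      steps-below {i} valid rounds (suc j) 1+j≤1+i = <-suc-extend earlier (step valid rounds earlier j≤i)
        where
        j≤i : j ≤ i
        j≤i = ℕ.≤-pred 1+j≤1+i
        earlier : ∀ k → k < j → Step i k
        earlier = steps-below valid rounds j (ℕ.m≤n⇒m≤1+n j≤i)

      rounds-valid : ∀ i → MovesValidBefore i → RoundValid i
      rounds-valid = <-rec (λ i → MovesValidBefore i → RoundValid i) λ i rec valid →
        steps-below valid (λ i′<i → rec i′<i (valid-weaken (ℕ.<⇒≤ i′<i) valid)) (suc i) ℕ.≤-refl

      diag∈prev : ∀ {i} → MovesValidBefore i → In[ pos s i , prev s i ] (stage s i i)
      diag∈prev {i} valid = stage∈prev valid (λ k k<i → rounds-valid i valid k (ℕ.m<n⇒m<1+n k<i))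

      move∈prev : ∀ {i} → MovesValidBefore i → In[ pos s i , prev s i ] (stage s (suc i) i)
      move∈prev {i} valid = stage∈prev valid (rounds-valid i valid)

      move≤gameSet : ∀ {i} → MovesValidBefore i →
                     stage s (suc i) i ≤R gameSet i (pos s i) (stage s i i)
      move≤gameSet {i} valid rewrite ℕ.n∸n≡0 i = proj₁ (aux-LegalI (proj₂ (diag∈prev valid)) λ _ ())

      pos-Lh : ∀ {i m} → MovesValidBefore i → Lh a m → Lh (pos s i) (i + m)
      pos-Lh {zero}  _     la = la
      pos-Lh {suc i} valid la =
        OneStep-Lh (proj₁ (valid i (ℕ.n<1+n i))) (pos-Lh (valid-weaken (ℕ.n≤1+n i) valid) la)

      module Main = Play a B₀ (λ n → δ (take n s)) s

      main-pos : ∀ n → Main.pos n ≡ pos s n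
      main-pos zero    = refl
      main-pos (suc n) = refl

      main-LegalII : ∀ {k} → Main.LegalII k → MoveII (pos s k) (stage s (suc k) k) (s k)
      main-LegalII {k} = subst₂ (λ b A → MoveII b A (s k)) (main-pos k) (δ-take s k)

      main-valid : ∀ {n} → (∀ k → k < n → Main.LegalII k) → MovesValidBefore n
      main-valid legal k k<n = main-LegalII (legal k k<n)

      main-LegalI : ∀ {n} → In[ pos s n , prev s n ] (stage s (suc n) n) → Main.LegalI n
      main-LegalI {zero}  = subst In[ a , B₀ ] (sym (δ-take s 0))
      main-LegalI {suc n} = subst In[ proj₁ (s n) , proj₂ (s n) ] (sym (δ-take s (suc n)))

      module _ (valid : ∀ n → MovesValidBefore n) where

        aux-valid : ∀ j k → Aux.LegalII j k
        aux-valid j k = aux-LegalII (valid _) (rounds-valid _ (valid _)) λ j′ j′<j →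
          rounds-valid _ (valid _) j′ (ℕ.m<n⇒m<1+n (ℕ.m<n⇒m<1+n (ℕ.<-≤-trans j′<j (ℕ.m≤m+n j k))))

        aux-outcome : ∀ {C} j → Main.IsOutcome C → Aux.IsOutcome j C
        aux-outcome j = Follows-drop j (◁⇒Lh a◁B₀) (pos-Lh (valid j) (◁⇒Lh a◁B₀))
                                       (λ t → trans (aux-pos j t) (sym (main-pos (j + t))))

    δ-legal : a ◁ B₀ → ILegal a B₀ δ
    δ-legal a◁B₀ s n legal = main-LegalI a◁B₀ s (move∈prev a◁B₀ s (main-valid a◁B₀ s legal))

  module _ (em : ExcludedMiddle 0ℓ) (𝒳 : ℕ → R → Set) (KR : ∀ n → KastanasRamsey (𝒳 n)) where

    ⋃𝒳 : R → Set
    ⋃𝒳 C = ∃[ n ] 𝒳 n C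

    KRWitness : ℕ → AR → R → Set
    KRWitness j b E =
      ∃[ B ] (In[ b , E ] B × (IHasStrategy b B (λ C → ¬ 𝒳 j C) ⊎ IIHasStrategy b B (𝒳 j)))

    witnessed : ∀ {j b E} → KRWitness j b E → R × StrategyI
    witnessed (B , _ , inj₁ (σ , _)) = B , σ
    witnessed (B , _ , inj₂ _)       = B , copycat B

    witnessed-legal : ∀ {j b E} (w : KRWitness j b E) → LegalReduction b E (witnessed w)
    witnessed-legal (B , B∈ , inj₁ (σ , σ-wins)) = B∈ , λ IIs → proj₁ (σ-wins IIs)
    witnessed-legal (B , B∈ , inj₂ _)           = B∈ , copycat-legal (proj₂ B∈)

    witnessed-wins : ∀ {j b E} → Bad ⋃𝒳 b E → (w : KRWitness j b E) →
                     IWinsWith b (proj₁ (witnessed w)) (λ C → ¬ 𝒳 j C) (proj₂ (witnessed w))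
    witnessed-wins     _   (B , _  , inj₁ (σ , σ-wins)) = σ-wins
    witnessed-wins {j} {b} bad (B , B∈ , inj₂ (τ , τ-wins)) = ⊥-elim (bad (B , B∈ , τ , τ-wins-⋃))
      where
      τ-wins-⋃ : IIWinsWith b B ⋃𝒳 τ
      τ-wins-⋃ Is = proj₁ (τ-wins Is) , λ legal C C-out → j , proj₂ (τ-wins Is) legal C C-out

    WinningReduction : ℕ → AR → R × StrategyI → Set
    WinningReduction j b (D , σ) = SuccessorsBad ⋃𝒳 b D × IWinsWith b D (λ C → ¬ 𝒳 j C) σ

    reduceWith : ℕ → (b : AR) (C : R) → Dec (SuccessorsBadBelow ⋃𝒳 b C) → R × StrategyI
    reduceWith j b C (yes (E , E∈ , _)) = witnessed (KR j E b (◁⇒AR↾ (proj₂ E∈)))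
    reduceWith j b C (no _)             = C , copycat C

    reduceWith-legal : ∀ j {b C} → b ◁ C → (d : Dec (SuccessorsBadBelow ⋃𝒳 b C)) →
                       LegalReduction b C (reduceWith j b C d)
    reduceWith-legal j {b} _ (yes (E , E∈ , _)) =
      let B∈ , σ-legal = witnessed-legal (KR j E b (◁⇒AR↾ (proj₂ E∈)))
      in In-mono B∈ (proj₁ E∈) , σ-legal
    reduceWith-legal j {C = C} b◁C (no _) = (≤-refl C , b◁C) , copycat-legal b◁C

    reduceWith-wins : ∀ j {b C} → b ◁ C → Bad ⋃𝒳 b C → (d : Dec (SuccessorsBadBelow ⋃𝒳 b C)) →
                      WinningReduction j b (reduceWith j b C d)
    reduceWith-wins j {b} _ bad (yes (E , E∈ , succBad)) =
      SuccessorsBad-antitone ⋃𝒳 (proj₁ (proj₁ (witnessed-legal w))) succBad ,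
      witnessed-wins (Bad-antitone ⋃𝒳 (proj₁ E∈) bad) w
      where
      w : KRWitness j b E
      w = KR j E b (◁⇒AR↾ (proj₂ E∈))
    reduceWith-wins j b◁C bad (no noE) = ⊥-elim (noE (bad⇒successorsBadBelow em ⋃𝒳 b◁C bad))

    reduce : ℕ → AR → R → R × StrategyI
    reduce j b C = reduceWith j b C em

    module Diag = Diagonal reduce (λ j b◁C → reduceWith-legal j b◁C em)

    module _ {a B₀} (a◁B₀ : a ◁ B₀) (bad₀ : Bad ⋃𝒳 a B₀) where
      open Diag a B₀

      module _ (s : ℕ → AR × R) (valid : ∀ n → MovesValidBefore a◁B₀ s n) where

        games-win : ∀ j → WinningReduction j (pos s j) (reduce j (pos s j) (stage s j j))

        bad-everywhere : ∀ i → Bad ⋃𝒳 (pos s i) (prev s i)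
        bad-everywhere zero    = bad₀
        bad-everywhere (suc i) =
          let step , II-set≤move , _ = valid (suc i) i (ℕ.n<1+n i)
              move≤Dᵢ = move≤gameSet a◁B₀ s (valid i)
          in Bad-antitone ⋃𝒳 (≤-trans II-set≤move move≤Dᵢ)
                          (proj₁ (games-win i) (OneStep-mono move≤Dᵢ step))

        games-win j =
          let stage≤prev , pos◁stage = diag∈prev a◁B₀ s (valid j)
          in reduceWith-wins j pos◁stage (Bad-antitone ⋃𝒳 stage≤prev (bad-everywhere j)) em

      δ-wins : IWinsWith a B₀ (λ C → ¬ ⋃𝒳 C) δ
      δ-wins s = δ-legal a◁B₀ s , λ legal C C-out (j , C∈𝒳ⱼ) →
        let valid : ∀ n → MovesValidBefore a◁B₀ s n
            valid n = main-valid a◁B₀ s (λ k _ → legal k)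
        in proj₂ (proj₂ (games-win s valid j) (auxII s j))
                 (aux-valid a◁B₀ s valid j) C (aux-outcome a◁B₀ s valid j C-out) C∈𝒳ⱼ

    ⋃𝒳-decided-below : ∀ {a A B₀} → In[ a , A ] B₀ →
      ∃[ B ] (In[ a , A ] B × (IHasStrategy a B (λ C → ¬ ⋃𝒳 C) ⊎ IIHasStrategy a B ⋃𝒳))
    ⋃𝒳-decided-below {a} {A} {B₀} B₀∈ with em {Good ⋃𝒳 a B₀}
    ... | yes (B , B∈ , τ) = B , In-mono B∈ (proj₁ B₀∈) , inj₂ τ
    ... | no bad           = B₀ , B₀∈ , inj₁ (Diag.δ a B₀ , δ-wins (proj₂ B₀∈) bad)

proposition3p6 : (S : Structure) → IsWA2Space S → ExcludedMiddle 0ℓ →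
    (𝒳 : ℕ → Structure.R S → Set) →
    (∀ n → Notions.KastanasRamsey S (𝒳 n)) →
    Notions.KastanasRamsey S (λ C → ∃[ n ] 𝒳 n C)
proposition3p6 S W em 𝒳 KR A a a∈A↾ =
  -- 𝒳 0 serves only to provide some B₀ ∈ [a , A], which a ∈ AR↾A does not give directly
  let B₀ , B₀∈[a,A] , _ = KR 0 A a a∈A↾ in ⋃𝒳-decided-below S W em 𝒳 KR B₀∈[a,A]
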